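{- Let $G$ be a connected graph and let $k$ be an integer with $1\le k<\frac{v(G)}{2}$. Then there are at most $\left\lfloor \frac{v(G)}{k+1}\right\rfloor$ vertices $v\in V(G)$ such that $G-v$ has a connected component with exactly $k$ vertices.
   Context: All graphs are finite and simple; $v(X)$ denotes the number of vertices of $X$, and $G-v$ is the graph obtained by deleting $v$ and its incident edges. -}

module Defs where

open import Data.Nat using (ℕ; zero; suc)
open import Data.Bool using (Bool; true; false)
open import Data.Fin using (Fin)
open import Data.Fin.Subset using (Subset; _∈_; _∉_; ∣_∣)
open import Data.Product using (∃; _×_)
open import Relation.Binary.PropositionalEquality using (_≡_; _≢_)

record Graph (n : ℕ) : Set where
  field
    adj    : Fin n → Fin n → Bool
    sym    : ∀ u w → adj u w ≡ adj w u
    irrefl : ∀ u → adj u u ≡ false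

open Graph public

v : ∀ {n} → Graph n → ℕ
v {n} _ = n

data Walk {n : ℕ} (G : Graph n) : Fin n → Fin n → Set where
  here : ∀ {u} → Walk G u u
  step : ∀ {u w x} → adj G u w ≡ true → Walk G w x → Walk G u x

Connected : ∀ {n} → Graph n → Set
Connected G = ∀ u w → Walk G u w

-- Walks in G - x: walks in G all of whose vertices differ from x
-- (i.e. walks in the induced subgraph on V(G) ∖ {x}).
data WalkAvoid {n : ℕ} (G : Graph n) (x : Fin n) : Fin n → Fin n → Set where
  here : ∀ {u} → u ≢ x → WalkAvoid G x u u
  step : ∀ {u w y} → u ≢ x → adj G u w ≡ true → WalkAvoid G x w y → WalkAvoid G x u y

-- S is (the vertex set of) a connected component of G - x:
-- a nonempty set of vertices of G - x, connected in G - x,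
-- and closed under adjacency in G - x (hence maximal).
record IsComponentOfDel {n : ℕ} (G : Graph n) (x : Fin n) (S : Subset n) : Set where
  field
    nonempty  : ∃ λ u → u ∈ S
    avoids    : x ∉ S
    connected : ∀ {u w} → u ∈ S → w ∈ S → WalkAvoid G x u w
    closed    : ∀ {u w} → u ∈ S → w ≢ x → adj G u w ≡ true → w ∈ S

HasComponentOfSize : ∀ {n} → Graph n → Fin n → ℕ → Set
HasComponentOfSize {n} G x k =
  ∃ λ (S : Subset n) → IsComponentOfDel G x S × ∣ S ∣ ≡ k

{-# OPTIONS --safe #-}
-- For x ∈ X let C x be a component of G - x with k vertices. The sets C x ∪ {x}
-- are pairwise disjoint and have k + 1 elements, whence ∣X∣ (k + 1) ≤ v(G).
-- First, y ∉ C x: otherwise either x ∈ C y, and then C y contains every vertex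
-- outside C x (they reach x without passing through C x ∋ y), so v(G) ≤ 2k; or
-- x ∉ C y, and then C y ⊆ C x - y is too small. Second, C x and C y cannot meet:
-- if they did, C x ⊆ C y, and since G is connected C x contains a neighbour of x,
-- which would force x ∈ C y.
module Submission where

open import Defs hiding (sym)
open IsComponentOfDel
open import Data.Bool using (true)
open import Data.Empty using (⊥-elim)
open import Data.Fin using (Fin; zero; suc)
open import Data.Fin.Properties using (_≟_)
open import Data.Fin.Subset
  using (Subset; _∈_; _∉_; _⊆_; ∣_∣; _∪_; _─_; _-_; ⁅_⁆; ⊥; ∁; Nonempty; inside; outside)
open import Data.Fin.Subset.Properties
  using ( _∈?_; ∉⊥; ∣⊥∣≡0; ∣⁅x⁆∣≡1; ∣∁p∣≡n∸∣p∣; p─⊥≡p; p─q⊆p; x∈⁅x⁆; x∈⁅y⁆⇒x≡y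
        ; x∈p∪q⁻; ∣p∣≤n; x∈∁p⇒x∉p; x∈p∧x≢y⇒x∈p-y; x∈p⇒∣p-x∣<∣p∣; p⊆q⇒∣p∣≤∣q∣)
open import Data.Nat using (ℕ; zero; suc; _+_; _*_; _∸_; _≤_; _<_; NonZero)
open import Data.Nat.DivMod using (_/_; m*n/n≡m; /-monoˡ-≤)
open import Data.Nat.Properties
  using ( <-irrefl; <⇒≱; ≤-<-trans; m≤n+m∸n; +-monoʳ-≤; +-comm; +-suc; +-identityʳ
        ; suc-injective; module ≤-Reasoning)
open import Data.Nat.Tactic.RingSolver using (solve-∀)
open import Data.Product using (∃; _×_; _,_; proj₁; proj₂)
open import Data.Sum using (inj₁; inj₂)
open import Data.Vec.Base using (_∷_; []; here; there)
open import Function using (_∘_; case_of_; _⇔_; mk⇔; Equivalence)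
open import Function.Construct.Composition using (_⇔-∘_)
open import Function.Construct.Identity using (⇔-id)
open import Relation.Nullary using (yes; no)
open import Relation.Binary.PropositionalEquality
  using (_≡_; _≢_; refl; sym; trans; cong; subst; subst₂; module ≡-Reasoning)

private
  variable
    n m : ℕ

Disjoint : Subset n → Subset n → Set
Disjoint p q = ∀ {i} → i ∈ p → i ∉ q

∣p∪q∣≡∣p∣+∣q∣ : (p q : Subset n) → Disjoint p q → ∣ p ∪ q ∣ ≡ ∣ p ∣ + ∣ q ∣
∣p∪q∣≡∣p∣+∣q∣ [] [] _ = refl
∣p∪q∣≡∣p∣+∣q∣ (inside ∷ p) (inside ∷ q) p#q = ⊥-elim (p#q here here)
∣p∪q∣≡∣p∣+∣q∣ (inside ∷ p) (outside ∷ q) p#q =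
  cong suc (∣p∪q∣≡∣p∣+∣q∣ p q λ i∈p i∈q → p#q (there i∈p) (there i∈q))
∣p∪q∣≡∣p∣+∣q∣ (outside ∷ p) (inside ∷ q) p#q =
  trans (cong suc (∣p∪q∣≡∣p∣+∣q∣ p q λ i∈p i∈q → p#q (there i∈p) (there i∈q)))
        (sym (+-suc ∣ p ∣ ∣ q ∣))
∣p∪q∣≡∣p∣+∣q∣ (outside ∷ p) (outside ∷ q) p#q =
  ∣p∪q∣≡∣p∣+∣q∣ p q λ i∈p i∈q → p#q (there i∈p) (there i∈q)

x∉p⇒∣p∪⁅x⁆∣≡1+∣p∣ : {x : Fin n} {p : Subset n} → x ∉ p → ∣ p ∪ ⁅ x ⁆ ∣ ≡ suc ∣ p ∣
x∉p⇒∣p∪⁅x⁆∣≡1+∣p∣ {x = x} {p} x∉p = begin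
  ∣ p ∪ ⁅ x ⁆ ∣       ≡⟨ ∣p∪q∣≡∣p∣+∣q∣ p ⁅ x ⁆ p#⁅x⁆ ⟩
  ∣ p ∣ + ∣ ⁅ x ⁆ ∣   ≡⟨ cong (∣ p ∣ +_) (∣⁅x⁆∣≡1 x) ⟩
  ∣ p ∣ + 1           ≡⟨ +-comm ∣ p ∣ 1 ⟩
  suc ∣ p ∣           ∎
  where
    open ≡-Reasoning
    p#⁅x⁆ : Disjoint p ⁅ x ⁆
    p#⁅x⁆ i∈p i∈⁅x⁆ = x∉p (subst (_∈ p) (x∈⁅y⁆⇒x≡y x i∈⁅x⁆) i∈p)

x∈p⇒∣p∣≡1+∣p-x∣ : {x : Fin n} (p : Subset n) → x ∈ p → ∣ p ∣ ≡ suc ∣ p - x ∣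
x∈p⇒∣p∣≡1+∣p-x∣ {x = zero} (inside ∷ p) here = cong (λ q → suc ∣ q ∣) (sym (p─⊥≡p p))
x∈p⇒∣p∣≡1+∣p-x∣ {x = suc x} (inside ∷ p) (there x∈p) = cong suc (x∈p⇒∣p∣≡1+∣p-x∣ p x∈p)
x∈p⇒∣p∣≡1+∣p-x∣ {x = suc x} (outside ∷ p) (there x∈p) = x∈p⇒∣p∣≡1+∣p-x∣ p x∈p

x∈p─q⇒x∉q : {x : Fin n} (p q : Subset n) → x ∈ p ─ q → x ∉ q
x∈p─q⇒x∉q (inside ∷ p) (outside ∷ q) here ()
x∈p─q⇒x∉q (_ ∷ p) (inside ∷ q) (there x∈p─q) (there x∈q) = x∈p─q⇒x∉q p q x∈p─q x∈q
x∈p─q⇒x∉q (_ ∷ p) (outside ∷ q) (there x∈p─q) (there x∈q) = x∈p─q⇒x∉q p q x∈p─q x∈q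

∣p∣≡1+s⇒Nonempty : ∀ {s} (p : Subset n) → ∣ p ∣ ≡ suc s → Nonempty p
∣p∣≡1+s⇒Nonempty (inside ∷ p) _ = zero , here
∣p∣≡1+s⇒Nonempty (outside ∷ p) ∣p∣≡1+s =
  let x , x∈p = ∣p∣≡1+s⇒Nonempty p ∣p∣≡1+s in suc x , there x∈p

∣∁p∣≤m⇒n≤∣p∣+m : (p : Subset n) → ∣ ∁ p ∣ ≤ m → n ≤ ∣ p ∣ + m
∣∁p∣≤m⇒n≤∣p∣+m {n} {m} p ∣∁p∣≤m = begin
  n                   ≤⟨ m≤n+m∸n n ∣ p ∣ ⟩
  ∣ p ∣ + (n ∸ ∣ p ∣) ≡⟨ cong (∣ p ∣ +_) (sym (∣∁p∣≡n∸∣p∣ p)) ⟩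
  ∣ p ∣ + ∣ ∁ p ∣     ≤⟨ +-monoʳ-≤ ∣ p ∣ ∣∁p∣≤m ⟩
  ∣ p ∣ + m           ∎
  where open ≤-Reasoning

private
  disjoint-family-bound-∪ :
    ∀ s (X : Subset n) → ∣ X ∣ ≡ s → (U : Subset n) (T : ∀ {x} → x ∈ X → Subset n)
    → (∀ {x} (x∈X : x ∈ X) → ∣ T x∈X ∣ ≡ m)
    → (∀ {x y} (x∈X : x ∈ X) (y∈X : y ∈ X) → x ≢ y → Disjoint (T x∈X) (T y∈X))
    → (∀ {x} (x∈X : x ∈ X) → Disjoint (T x∈X) U)
    → s * m + ∣ U ∣ ≤ n
  disjoint-family-bound-∪ zero X _ U _ _ _ _ = ∣p∣≤n U
  disjoint-family-bound-∪ {n} {m} (suc s) X ∣X∣≡1+s U T ∣T∣≡m T-disjoint T#U = begin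
    suc s * m + ∣ U ∣       ≡⟨ rearrange s m ∣ U ∣ ⟩
    s * m + (∣ U ∣ + m)     ≡⟨ cong (λ t → s * m + (∣ U ∣ + t)) (sym (∣T∣≡m x∈X)) ⟩
    s * m + (∣ U ∣ + ∣ Tx ∣) ≡⟨ cong (s * m +_) (sym (∣p∪q∣≡∣p∣+∣q∣ U Tx U#Tx)) ⟩
    s * m + ∣ U ∪ Tx ∣      ≤⟨ disjoint-family-bound-∪ s (X - x) ∣X-x∣≡s (U ∪ Tx) (T ∘ ∈X)
                                 (∣T∣≡m ∘ ∈X) (λ y∈ z∈ → T-disjoint (∈X y∈) (∈X z∈)) T'#U∪Tx ⟩
    n                       ∎
    where
      open ≤-Reasoning
      rearrange : ∀ s m u → suc s * m + u ≡ s * m + (u + m)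
      rearrange = solve-∀
      x : Fin _
      x = proj₁ (∣p∣≡1+s⇒Nonempty X ∣X∣≡1+s)
      x∈X : x ∈ X
      x∈X = proj₂ (∣p∣≡1+s⇒Nonempty X ∣X∣≡1+s)
      Tx : Subset _
      Tx = T x∈X
      ∣X-x∣≡s : ∣ X - x ∣ ≡ s
      ∣X-x∣≡s = suc-injective (trans (sym (x∈p⇒∣p∣≡1+∣p-x∣ X x∈X)) ∣X∣≡1+s)
      U#Tx : Disjoint U Tx
      U#Tx i∈U i∈Tx = T#U x∈X i∈Tx i∈U
      ∈X : ∀ {y} → y ∈ X - x → y ∈ X
      ∈X = p─q⊆p X ⁅ x ⁆
      T'#U∪Tx : ∀ {y} (y∈X-x : y ∈ X - x) → Disjoint (T (∈X y∈X-x)) (U ∪ Tx)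
      T'#U∪Tx {y} y∈X-x i∈Ty i∈U∪Tx with x∈p∪q⁻ U Tx i∈U∪Tx
      ... | inj₁ i∈U  = T#U (∈X y∈X-x) i∈Ty i∈U
      ... | inj₂ i∈Tx = T-disjoint (∈X y∈X-x) x∈X y≢x i∈Ty i∈Tx
        where
          y≢x : y ≢ x
          y≢x refl = x∈p─q⇒x∉q X ⁅ x ⁆ y∈X-x (x∈⁅x⁆ x)

disjoint-family-bound :
  (X : Subset n) (T : ∀ {x} → x ∈ X → Subset n)
  → (∀ {x} (x∈X : x ∈ X) → ∣ T x∈X ∣ ≡ m)
  → (∀ {x y} (x∈X : x ∈ X) (y∈X : y ∈ X) → x ≢ y → Disjoint (T x∈X) (T y∈X))
  → ∣ X ∣ * m ≤ n
disjoint-family-bound {n} {m} X T ∣T∣≡m T-disjoint =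
  subst (_≤ n) (trans (cong (∣ X ∣ * m +_) (∣⊥∣≡0 n)) (+-identityʳ (∣ X ∣ * m)))
    (disjoint-family-bound-∪ ∣ X ∣ X refl ⊥ T ∣T∣≡m T-disjoint (λ _ _ → ∉⊥))

m*o≤n⇒m≤n/o : ∀ {m n} o .{{_ : NonZero o}} → m * o ≤ n → m ≤ n / o
m*o≤n⇒m≤n/o {m} {n} o m*o≤n = subst (_≤ n / o) (m*n/n≡m m o) (/-monoˡ-≤ o m*o≤n)

module _ (G : Graph n) where

  private
    variable
      x y u w : Fin n
      C D : Subset n

    adj-sym : adj G u w ≡ true → adj G w u ≡ true
    adj-sym {u = u} {w = w} u~w = trans (Graph.sym G w u) u~w

    ∈∧∉⇒≢ : y ∈ C → u ∉ C → u ≢ y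
    ∈∧∉⇒≢ y∈C u∉C refl = u∉C y∈C

  WalkAvoid-start≢ : WalkAvoid G x u w → u ≢ x
  WalkAvoid-start≢ (here u≢x)     = u≢x
  WalkAvoid-start≢ (step u≢x _ _) = u≢x

  adjacent-∈⇔ : IsComponentOfDel G y D → u ≢ y → w ≢ y → adj G u w ≡ true → (u ∈ D ⇔ w ∈ D)
  adjacent-∈⇔ D-comp u≢y w≢y u~w =
    mk⇔ (λ u∈D → closed D-comp u∈D w≢y u~w) (λ w∈D → closed D-comp w∈D u≢y (adj-sym u~w))

  component-⊆ : IsComponentOfDel G x C → IsComponentOfDel G y D → y ∉ C → u ∈ C → u ∈ D → C ⊆ D
  component-⊆ {x = x} {C = C} {D = D} C-comp D-comp y∉C u∈C u∈D w∈C =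
    along (connected C-comp u∈C w∈C) u∈C u∈D
    where
      along : ∀ {a b} → WalkAvoid G x a b → a ∈ C → a ∈ D → b ∈ D
      along (here _) _ a∈D = a∈D
      along (step {w = c} _ a~c rest) a∈C a∈D =
        along rest c∈C (closed D-comp a∈D (∈∧∉⇒≢ c∈C y∉C ∘ sym) a~c)
        where
          c∈C : c ∈ C
          c∈C = closed C-comp a∈C (WalkAvoid-start≢ rest) a~c

  -- A walk from u to x stays outside C (and hence avoids y) until it reaches x.
  ∉-component⇒∈⇔ : IsComponentOfDel G x C → IsComponentOfDel G y D → y ∈ C
    → u ∉ C → Walk G u x → (u ∈ D ⇔ x ∈ D)
  ∉-component⇒∈⇔ _ _ _ _ here = ⇔-id _
  ∉-component⇒∈⇔ {x = x} {C = C} {u = u} C-comp D-comp y∈C u∉C (step {w = w} u~w rest)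
    with w ∈? C
  ... | no w∉C =
    ∉-component⇒∈⇔ C-comp D-comp y∈C w∉C rest
      ⇔-∘ adjacent-∈⇔ D-comp (∈∧∉⇒≢ y∈C u∉C) (∈∧∉⇒≢ y∈C w∉C) u~w
  ... | yes w∈C with u ≟ x
  ...   | yes refl = ⇔-id _
  ...   | no u≢x   = ⊥-elim (u∉C (closed C-comp w∈C u≢x (adj-sym u~w)))

  leaving-component⇒neighbour : IsComponentOfDel G x C → u ∈ C → Walk G u w → w ∉ C
    → ∃ λ c → c ∈ C × adj G c x ≡ true
  leaving-component⇒neighbour _ u∈C here t∉C = ⊥-elim (t∉C u∈C)
  leaving-component⇒neighbour {x = x} {C = C} {u = u} C-comp u∈C (step {w = w} u~w rest) t∉C
    with w ∈? C
  ... | yes w∈C = leaving-component⇒neighbour C-comp w∈C rest t∉C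
  ... | no w∉C with w ≟ x
  ...   | yes refl = u , u∈C , u~w
  ...   | no w≢x   = ⊥-elim (w∉C (closed C-comp u∈C w≢x u~w))

  module _ (G-connected : Connected G) where

    components-disjoint : IsComponentOfDel G x C → IsComponentOfDel G y D
      → x ≢ y → y ∉ C → x ∉ D → Disjoint C D
    components-disjoint {x = x} C-comp D-comp x≢y y∉C x∉D u∈C u∈D =
      let c , c∈C , c~x = leaving-component⇒neighbour C-comp u∈C (G-connected _ x) (avoids C-comp)
      in x∉D (closed D-comp (component-⊆ C-comp D-comp y∉C u∈C u∈D c∈C) x≢y c~x)

    module _ {k : ℕ} (2k<n : 2 * k < n) where

      k-component-∌ : IsComponentOfDel G x C → ∣ C ∣ ≡ k
        → IsComponentOfDel G y D → ∣ D ∣ ≡ k → y ∉ C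
      k-component-∌ {x = x} {C = C} {y = y} {D = D} C-comp ∣C∣≡k D-comp ∣D∣≡k y∈C
        with x ∈? D
      ... | yes x∈D = <⇒≱ 2k<n n≤2k
        where
          ∁C⊆D : ∁ C ⊆ D
          ∁C⊆D {u} u∈∁C =
            Equivalence.from (∉-component⇒∈⇔ C-comp D-comp y∈C (x∈∁p⇒x∉p u∈∁C) (G-connected u x)) x∈D
          n≤2k : n ≤ 2 * k
          n≤2k = subst₂ (λ a b → n ≤ a + b) ∣C∣≡k (trans ∣D∣≡k (sym (+-identityʳ k)))
                   (∣∁p∣≤m⇒n≤∣p∣+m C (p⊆q⇒∣p∣≤∣q∣ ∁C⊆D))
      ... | no x∉D with nonempty D-comp
      ...   | d , d∈D with d ∈? C
      ...     | no d∉C  =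
        x∉D (Equivalence.to (∉-component⇒∈⇔ C-comp D-comp y∈C d∉C (G-connected d x)) d∈D)
      ...     | yes d∈C =
        <-irrefl (trans ∣D∣≡k (sym ∣C∣≡k)) (≤-<-trans (p⊆q⇒∣p∣≤∣q∣ D⊆C-y) (x∈p⇒∣p-x∣<∣p∣ y∈C))
        where
          D⊆C-y : D ⊆ C - y
          D⊆C-y {e} e∈D = x∈p∧x≢y⇒x∈p-y (component-⊆ D-comp C-comp x∉D d∈D d∈C e∈D)
                                         (λ { refl → avoids D-comp e∈D })

      k-components-∪-disjoint : IsComponentOfDel G x C → ∣ C ∣ ≡ k
        → IsComponentOfDel G y D → ∣ D ∣ ≡ k → x ≢ y
        → Disjoint (C ∪ ⁅ x ⁆) (D ∪ ⁅ y ⁆)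
      k-components-∪-disjoint {x = x} {C = C} {y = y} {D = D}
                              C-comp ∣C∣≡k D-comp ∣D∣≡k x≢y u∈C∪x u∈D∪y =
        case (x∈p∪q⁻ C ⁅ x ⁆ u∈C∪x , x∈p∪q⁻ D ⁅ y ⁆ u∈D∪y) of λ where
          (inj₁ u∈C , inj₁ u∈D) → components-disjoint C-comp D-comp x≢y y∉C x∉D u∈C u∈D
          (inj₁ u∈C , inj₂ u∈y) → y∉C (subst (_∈ C) (x∈⁅y⁆⇒x≡y y u∈y) u∈C)
          (inj₂ u∈x , inj₁ u∈D) → x∉D (subst (_∈ D) (x∈⁅y⁆⇒x≡y x u∈x) u∈D)
          (inj₂ u∈x , inj₂ u∈y) → x≢y (trans (sym (x∈⁅y⁆⇒x≡y x u∈x)) (x∈⁅y⁆⇒x≡y y u∈y))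
        where
          y∉C : y ∉ C
          y∉C = k-component-∌ C-comp ∣C∣≡k D-comp ∣D∣≡k
          x∉D : x ∉ D
          x∉D = k-component-∌ D-comp ∣D∣≡k C-comp ∣C∣≡k

corollary8 : ∀ {n} (G : Graph n) (k : ℕ) → Connected G
    → 1 ≤ k → 2 * k < v G
    → (X : Subset n) → (∀ {x} → x ∈ X → HasComponentOfSize G x k)
    → ∣ X ∣ ≤ v G / suc k
corollary8 G k G-connected _ 2k<n X has-k-component =
  m*o≤n⇒m≤n/o (suc k) (disjoint-family-bound X C∪x ∣C∪x∣≡1+k C∪x-disjoint)
  where
    C : ∀ {x} → x ∈ X → Subset _
    C x∈X = proj₁ (has-k-component x∈X)
    C-comp : ∀ {x} (x∈X : x ∈ X) → IsComponentOfDel G x (C x∈X)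
    C-comp x∈X = proj₁ (proj₂ (has-k-component x∈X))
    ∣C∣≡k : ∀ {x} (x∈X : x ∈ X) → ∣ C x∈X ∣ ≡ k
    ∣C∣≡k x∈X = proj₂ (proj₂ (has-k-component x∈X))
    C∪x : ∀ {x} → x ∈ X → Subset _
    C∪x {x} x∈X = C x∈X ∪ ⁅ x ⁆
    ∣C∪x∣≡1+k : ∀ {x} (x∈X : x ∈ X) → ∣ C∪x x∈X ∣ ≡ suc k
    ∣C∪x∣≡1+k x∈X = trans (x∉p⇒∣p∪⁅x⁆∣≡1+∣p∣ (avoids (C-comp x∈X))) (cong suc (∣C∣≡k x∈X))
    C∪x-disjoint : ∀ {x y} (x∈X : x ∈ X) (y∈X : y ∈ X) → x ≢ y → Disjoint (C∪x x∈X) (C∪x y∈X)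
    C∪x-disjoint x∈X y∈X =
      k-components-∪-disjoint G G-connected 2k<n (C-comp x∈X) (∣C∣≡k x∈X) (C-comp y∈X) (∣C∣≡k y∈X)
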